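{- Let $\sigma$ be a permutation of $\{1,\dots,b\}$, let $n\ge1$, and let $k$ be an integer with $b-L(\sigma)\le k\le b$. Then there is a bijection between edge-labeled multi-digraphs without loops having $n$ arcs (labeled $1,\dots,n$) on $k$ vertices, and juggling card sequences $A$ of length $n$ using cards $C_S$ with $|S|=2$ (two balls caught and thrown at a time) in which a total of exactly $k$ distinct balls are thrown and with $\pi_A=\sigma$.
   Context: There are $b$ balls on levels $1,\dots,b$. For an ordered pair $S=(s_1,s_2)$ of distinct elements of $[b]$, the card $C_S$ induces the permutation $\pi_{C_S}$ of $[b]$ with $\pi_{C_S}(1)=s_1$, $\pi_{C_S}(2)=s_2$, and $\pi_{C_S}$ restricted to $\{3,\dots,b\}$ the order-preserving bijection onto $[b]\setminus\{s_1,s_2\}$; the balls thrown at the card are those at left levels $1$ and $2$. For $A=C_{S_1}\cdots C_{S_n}$, starting with ball $j$ at level $j$ and passing through the cards left to right, $\pi_A(j)$ is the final level of ball $j$, i.e. $\pi_A=\pi_{C_{S_n}}\circ\cdots\circ\pi_{C_{S_1}}$. For a permutation $\sigma$ of $[b]$, $L(\sigma)$ is the largest $\ell$ with $\sigma(b-\ell+1)<\cdots<\sigma(b)$. The digraphs are counted with unlabeled vertices (up to isomorphism preserving arc labels and directions), with distinct labels $1,\dots,n$ on the arcs, parallel arcs allowed, no loops, and every vertex incident to at least one arc. -}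

module Defs where

open import Data.Nat using (ℕ; zero; suc; _<ᵇ_)
open import Data.Bool using (Bool; true; false; if_then_else_; _∨_)
open import Data.Fin using (Fin; zero; suc; toℕ; _≟_)
open import Data.Fin.Permutation using (Permutation′; _⟨$⟩ʳ_; _⟨$⟩ˡ_; id; flip; _∘ₚ_; inverseˡ; inverseʳ)
open import Data.Product using (Σ; _×_; _,_; proj₁; proj₂; ∃)
open import Data.Sum using (_⊎_)
open import Data.List using (List; []; _∷_; filter; length; reverse; map; allFin)
open import Data.Vec using (Vec)
import Data.Vec as V
open import Data.Vec.Properties using (map-∘; map-id; map-cong)
open import Data.Vec.Relation.Unary.All using (All)
open import Data.Vec.Relation.Unary.Any using (Any)
open import Relation.Nullary using (¬_; ¬?)
open import Relation.Nullary.Decidable using (_×-dec_)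
open import Relation.Binary.Bundles using (Setoid)
open import Relation.Binary.PropositionalEquality
  using (_≡_; _≢_; refl; sym; trans; cong; isEquivalence)

-- Levels are Fin b (level i+1 of the paper is the index i : Fin b).

-- A card C_S for S = (s₁ , s₂); distinctness is imposed separately.
Card : ℕ → Set
Card b = Fin b × Fin b

-- nth element of a list, with a default (never used for valid inputs)
nth : {A : Set} → A → List A → ℕ → A
nth d []       _       = d
nth d (x ∷ xs) zero    = x
nth d (x ∷ xs) (suc m) = nth d xs m

complement : ∀ {b} → Card b → List (Fin b)
complement {b} (s₁ , s₂) = filter (λ x → ¬? (x ≟ s₁) ×-dec ¬? (x ≟ s₂)) (allFin b)

πC : ∀ {b} → Card b → Fin b → Fin b
πC (s₁ , s₂) zero                = s₁
πC (s₁ , s₂) (suc zero)          = s₂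
πC c         j@(suc (suc m))     = nth j (complement c) (toℕ m)

finalPos : ∀ {b} → List (Card b) → Fin b → Fin b
finalPos []       p = p
finalPos (c ∷ cs) p = finalPos cs (πC c p)

-- π_A as a function: ball j starts at level j
πA : ∀ {b n} → Vec (Card b) n → Fin b → Fin b
πA A j = finalPos (V.toList A) j

-- is the ball currently at level p thrown at some card of the list?
-- (thrown balls are those at levels 1 and 2, i.e. indices 0 and 1)
thrownFrom : ∀ {b} → List (Card b) → Fin b → Bool
thrownFrom []       p = false
thrownFrom (c ∷ cs) p = (toℕ p <ᵇ 2) ∨ thrownFrom cs (πC c p)

numThrown : ∀ {b n} → Vec (Card b) n → ℕ
numThrown {b} A =
  length (filter (λ j → thrownFrom (V.toList A) j Data.Bool.≟ true) (allFin b))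
  where import Data.Bool

ValidCard : ∀ {b} → Card b → Set
ValidCard (s₁ , s₂) = s₁ ≢ s₂

CardSeq : (b n k : ℕ) → Permutation′ b → Set
CardSeq b n k σ =
  Σ (Vec (Card b) n) λ A →
    All ValidCard A × (numThrown A ≡ k) × (∀ j → πA A j ≡ σ ⟨$⟩ʳ j)

CardSeqSetoid : (b n k : ℕ) → Permutation′ b → Setoid _ _
CardSeqSetoid b n k σ = record
  { Carrier       = CardSeq b n k σ
  ; _≈_           = λ A B → proj₁ A ≡ proj₁ B
  ; isEquivalence = record { refl = refl ; sym = sym ; trans = trans }
  }

-- L(σ): largest ℓ with σ(b-ℓ+1) < ... < σ(b)

decRun : ℕ → List ℕ → ℕ
decRun x []       = 0
decRun x (y ∷ ys) = if y <ᵇ x then suc (decRun y ys) else 0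

decPrefix : List ℕ → ℕ
decPrefix []       = 0
decPrefix (x ∷ xs) = suc (decRun x xs)

-- values σ(b), σ(b-1), ..., σ(1); an increasing suffix of σ is a
-- decreasing prefix of this list
L : ∀ {b} → Permutation′ b → ℕ
L {b} σ = decPrefix (reverse (map (λ j → toℕ (σ ⟨$⟩ʳ j)) (allFin b)))

-- Edge-labeled loopless multi-digraphs with n arcs on k vertices
-- (vertex set Fin k, arc i is the pair (tail , head)), every vertex
-- incident to an arc; counted up to vertex relabeling.

Arc : ℕ → Set
Arc k = Fin k × Fin k

IsDigraph : ∀ {n k} → Vec (Arc k) n → Set
IsDigraph {n} {k} G =
  All (λ a → proj₁ a ≢ proj₂ a) G ×
  (∀ (v : Fin k) → Any (λ a → (proj₁ a ≡ v) ⊎ (proj₂ a ≡ v)) G)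

Digraph : ℕ → ℕ → Set
Digraph n k = Σ (Vec (Arc k) n) IsDigraph

relabel : ∀ {n k} → Permutation′ k → Vec (Arc k) n → Vec (Arc k) n
relabel π = V.map (λ a → (π ⟨$⟩ʳ proj₁ a , π ⟨$⟩ʳ proj₂ a))

_≅_ : ∀ {n k} → Digraph n k → Digraph n k → Set
_≅_ {n} {k} G H = ∃ λ (π : Permutation′ k) → relabel π (proj₁ G) ≡ proj₁ H

private
  ≅-refl : ∀ {n k} {G : Digraph n k} → G ≅ G
  ≅-refl {G = G} = id , trans (map-cong (λ _ → refl) (proj₁ G)) (map-id (proj₁ G))

  ≅-sym : ∀ {n k} {G H : Digraph n k} → G ≅ H → H ≅ G
  ≅-sym {G = G} {H} (π , eq) = flip π , (begin
      relabel (flip π) (proj₁ H)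
        ≡⟨ cong (relabel (flip π)) (sym eq) ⟩
      relabel (flip π) (relabel π (proj₁ G))
        ≡⟨ sym (map-∘ _ _ (proj₁ G)) ⟩
      V.map _ (proj₁ G)
        ≡⟨ map-cong (λ a → cong₂ _,_ (inverseˡ π) (inverseˡ π)) (proj₁ G) ⟩
      V.map (λ a → a) (proj₁ G)
        ≡⟨ map-id (proj₁ G) ⟩
      proj₁ G ∎)
    where open Relation.Binary.PropositionalEquality.≡-Reasoning
          open Relation.Binary.PropositionalEquality using (cong₂)

  ≅-trans : ∀ {n k} {G H I : Digraph n k} → G ≅ H → H ≅ I → G ≅ I
  ≅-trans {G = G} {H} {I} (π , p) (ρ , q) = (π ∘ₚ ρ) , (begin
      relabel (π ∘ₚ ρ) (proj₁ G)
        ≡⟨ map-cong (λ a → refl) (proj₁ G) ⟩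
      V.map _ (proj₁ G)
        ≡⟨ map-∘ _ _ (proj₁ G) ⟩
      relabel ρ (relabel π (proj₁ G))
        ≡⟨ cong (relabel ρ) p ⟩
      relabel ρ (proj₁ H)
        ≡⟨ q ⟩
      proj₁ I ∎)
    where open Relation.Binary.PropositionalEquality.≡-Reasoning

DigraphSetoid : ℕ → ℕ → Setoid _ _
DigraphSetoid n k = record
  { Carrier       = Digraph n k
  ; _≈_           = _≅_
  ; isEquivalence = record { refl = λ {G} → ≅-refl {G = G}
                           ; sym = λ {G} {H} → ≅-sym {G = G} {H}
                           ; trans = λ {G} {H} {I} → ≅-trans {G = G} {H} {I} }
  }

module Submission where

-- Both sides of the bijection are matched with "standard" pair sequences:
-- n pairs of distinct balls whose distinct entries, in order of first
-- appearance, are 0, 1, …, k-1.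
--  * A digraph gives one by numbering its vertices in order of first
--    appearance along the arcs; isomorphic digraphs give the same sequence,
--    and turning the balls back into vertices inverts the numbering.
--  * A card sequence gives one by labelling each final level with the ball
--    σ⁻¹ sends there and recording the pair thrown at each card.  Read
--    backwards, a card lifts its two balls to levels 1, 2 ('raise'), so the
--    initial arrangement 0, …, b-1 is the final one restacked by the pairs;
--    hence the thrown balls are 0, …, k-1.  As σ increases on its last
--    L(σ) ≥ b - k levels, every standard sequence comes from exactly one
--    card sequence.

open import Defs
open import Data.Bool using (true; false) renaming (_≟_ to _≟𝔹_; T to True)
open import Data.Empty using (⊥-elim)
open import Data.Fin using (Fin; zero; suc; toℕ; _≟_; fromℕ<; inject≤) renaming (_<_ to _<ᶠ_)
import Data.Fin.Properties as Fin
open import Data.Fin.Properties using (toℕ-injective; toℕ<n; toℕ-fromℕ<; toℕ-inject≤) renaming (any? to anyFin?)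
open import Data.Fin.Permutation using (Permutation′; _⟨$⟩ʳ_; _⟨$⟩ˡ_; inverseˡ; inverseʳ; permutation)
open import Data.List
  using (List; []; _∷_; map; filter; length; _++_; foldr; drop; take; tabulate; allFin; reverse)
open import Data.List.Properties
  using (filter-accept; filter-reject; filter-++; filter-all; filter-none; filter-≐; ∷-injective;
         map-∘; map-id; map-cong; map-cong-local; map-++; map-tabulate; map-injective; length-map;
         length-tabulate; length-reverse; length-drop; ++-identityʳ; unfold-reverse; reverse-++;
         reverse-involutive; take++drop≡id; drop-map)
open import Data.List.Membership.Propositional using (_∈_; _∉_)
open import Data.List.Membership.Propositional.Properties
  using (∈-filter⁺; ∈-filter⁻; ∈-map⁺; ∈-map⁻; ∈-allFin)
open import Data.List.Relation.Unary.All as All using (All; []; _∷_)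
import Data.List.Relation.Unary.All.Properties as AllP
open import Data.List.Relation.Unary.AllPairs using (AllPairs; []; _∷_)
import Data.List.Relation.Unary.AllPairs.Properties as AllPairsP
open import Data.List.Relation.Unary.Any as Any using (Any; here; there; any?)
import Data.List.Relation.Unary.Any.Properties as AnyP
open import Data.List.Relation.Unary.Unique.Propositional using (Unique)
open import Data.List.Relation.Unary.Unique.Propositional.Properties
  using (filter⁺; Unique[x∷xs]⇒x∉xs; allFin⁺)
open import Data.Nat using (ℕ; zero; suc; _≤_; _<_; _>_; _∸_; _+_; z≤n; s≤s; _<ᵇ_; _≤?_; _<?_)
open import Data.Nat.Properties
  using (suc-injective; +-identityʳ; +-suc; +-comm; +-monoʳ-≤; ≤-refl; <⇒≤; <⇒≱; ≤∧≢⇒<; ≮⇒≥;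
         <-trans; <ᵇ⇒<; m<m+n; m+[n∸m]≡n; m≤n+o⇒m∸n≤o; m≤n+m∸n; module ≤-Reasoning)
  renaming (_≟_ to _≟ℕ_)
open import Data.Product using (Σ; _×_; _,_; proj₁; proj₂; ∃; swap)
open import Data.Sum using (_⊎_; inj₁; inj₂)
open import Data.Vec using (Vec; []; _∷_; toList)
import Data.Vec as V
import Data.Vec.Properties as VP
open import Data.Vec.Relation.Binary.Equality.Cast using (cast-is-id)
import Data.Vec.Relation.Unary.All as VAll
import Data.Vec.Relation.Unary.All.Properties as VAllP
import Data.Vec.Relation.Unary.Any as VAny
import Data.Vec.Relation.Unary.Any.Properties as VAnyP
open import Function using (_∘_; id; flip)
open import Function.Bundles using (Bijection; Inverse)
open import Function.Construct.Composition using (inverse)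
open import Function.Definitions using (Injective)
open import Function.Properties.Inverse using (Inverse⇒Bijection)
open import Level using (0ℓ)
open import Relation.Binary.Bundles using (Setoid)
import Relation.Binary.Construct.On as On
open import Relation.Binary.Definitions using (Transitive)
import Relation.Binary.PropositionalEquality as ≡
open import Relation.Binary.PropositionalEquality
  using (_≡_; _≢_; refl; sym; trans; cong; cong₂; subst; ≢-sym; module ≡-Reasoning)
open import Relation.Nullary using (Dec; ¬_; ¬?; yes; no)
open import Relation.Nullary.Decidable using (_×-dec_)
open import Relation.Unary using (Decidable)

-- Lists of pairs and the order in which their entries first appear.
-- Throughout, 'Pair m' is an ordered pair of elements of Fin m: a card, a
-- pair of balls thrown together, or an arc (tail , head) of a digraph.

private
  variable
    m m′ : ℕ

Pair : ℕ → Set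
Pair m = Fin m × Fin m

Loopless : List (Pair m) → Set
Loopless = All (λ p → proj₁ p ≢ proj₂ p)

Incident : Fin m → List (Pair m) → Set
Incident z = Any (λ p → (proj₁ p ≡ z) ⊎ (proj₂ p ≡ z))

_∈?_ : (z : Fin m) (zs : List (Fin m)) → Dec (z ∈ zs)
z ∈? zs = any? (z ≟_) zs

mapPair : (Fin m → Fin m′) → Pair m → Pair m′
mapPair f p = f (proj₁ p) , f (proj₂ p)

mapPair-cong : {f g : Fin m → Fin m′} → (∀ v → f v ≡ g v) → ∀ p → mapPair f p ≡ mapPair g p
mapPair-cong f≗g p = cong₂ _,_ (f≗g (proj₁ p)) (f≗g (proj₂ p))

∈-tail : ∀ {A : Set} {x z : A} {xs} → z ∈ x ∷ xs → x ≢ z → z ∈ xs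
∈-tail (here refl) x≢z = ⊥-elim (x≢z refl)
∈-tail (there z∈)  _   = z∈

avoids? : (x y : Fin m) → Decidable (λ (z : Fin m) → z ≢ x × z ≢ y)
avoids? x y z = ¬? (z ≟ x) ×-dec ¬? (z ≟ y)

-- zs with x and y deleted; for zs = allFin this is 'complement (x , y)'
remove : Fin m → Fin m → List (Fin m) → List (Fin m)
remove x y = filter (avoids? x y)

raise : Pair m → List (Fin m) → List (Fin m)
raise (x , y) zs = x ∷ y ∷ remove x y zs

restack : List (Pair m) → List (Fin m) → List (Fin m)
restack P zs = foldr raise zs P

-- the distinct entries of P in order of first appearance
firstSeen : List (Pair m) → List (Fin m)
firstSeen P = restack P []

untouched : List (Pair m) → List (Fin m) → List (Fin m)
untouched P zs = foldr (λ p → remove (proj₁ p) (proj₂ p)) zs P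

remove-keep : ∀ {x y z : Fin m} zs → z ≢ x → z ≢ y → remove x y (z ∷ zs) ≡ z ∷ remove x y zs
remove-keep {x = x} {y = y} zs z≢x z≢y = filter-accept (avoids? x y) (z≢x , z≢y)

remove-drop₁ : ∀ {x y : Fin m} zs → remove x y (x ∷ zs) ≡ remove x y zs
remove-drop₁ {x = x} {y = y} zs = filter-reject (avoids? x y) (λ p → proj₁ p refl)

remove-drop₂ : ∀ {x y : Fin m} zs → remove x y (y ∷ zs) ≡ remove x y zs
remove-drop₂ {x = x} {y = y} zs = filter-reject (avoids? x y) (λ p → proj₂ p refl)

∈-remove⁻ : ∀ {x y z : Fin m} {zs} → z ∈ remove x y zs → z ∈ zs × z ≢ x × z ≢ y
∈-remove⁻ {x = x} {y = y} = ∈-filter⁻ (avoids? x y)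

∈-remove⁺ : ∀ {x y z : Fin m} {zs} → z ∈ zs → z ≢ x → z ≢ y → z ∈ remove x y zs
∈-remove⁺ {x = x} {y = y} z∈ z≢x z≢y = ∈-filter⁺ (avoids? x y) z∈ (z≢x , z≢y)

remove-absent : ∀ {x y : Fin m} zs → x ∉ zs → y ∉ zs → remove x y zs ≡ zs
remove-absent {x = x} {y = y} zs x∉ y∉ = filter-all (avoids? x y)
  (All.tabulate (λ {z} z∈ → (λ e → x∉ (subst (_∈ zs) e z∈)) , (λ e → y∉ (subst (_∈ zs) e z∈))))

remove-comm : ∀ (x y : Fin m) zs → remove x y zs ≡ remove y x zs
remove-comm x y = filter-≐ (avoids? x y) (avoids? y x) (swap , swap)

-- in a list without repetitions, deleting one present element shortens it by one
-- (the case splits test 'x ≟ z' rather than 'z ≟ x' so that 'with' does not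
-- abstract over the test inside 'remove')
length-remove₁ : ∀ {x y : Fin m} zs → Unique zs → x ∈ zs → y ∉ zs → suc (length (remove x y zs)) ≡ length zs
length-remove₁ {x = x} {y = y} (z ∷ zs) u (here refl) y∉
  rewrite remove-drop₁ {x = x} {y = y} zs
        | remove-absent {x = x} {y = y} zs (Unique[x∷xs]⇒x∉xs u) (λ y∈ → y∉ (there y∈)) = refl
length-remove₁ {x = x} {y = y} (z ∷ zs) u@(_ ∷ u′) (there x∈) y∉ with x ≟ z
... | yes refl = ⊥-elim (Unique[x∷xs]⇒x∉xs u x∈)
... | no x≢z rewrite remove-keep zs (≢-sym x≢z) (λ z≡y → y∉ (here (sym z≡y))) =
  cong suc (length-remove₁ zs u′ x∈ (λ y∈ → y∉ (there y∈)))

length-remove : ∀ {x y : Fin m} zs → Unique zs → x ∈ zs → y ∈ zs → x ≢ y →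
                suc (suc (length (remove x y zs))) ≡ length zs
length-remove {x = x} {y = y} (z ∷ zs) u@(_ ∷ u′) x∈ y∈ x≢y with x ≟ z | y ≟ z
... | yes refl | _ rewrite remove-drop₁ {x = x} {y = y} zs =
  cong suc (trans (cong (suc ∘ length) (remove-comm x y zs))
                  (length-remove₁ zs u′ (∈-tail y∈ x≢y) (Unique[x∷xs]⇒x∉xs u)))
... | no x≢z | yes refl rewrite remove-drop₂ {x = x} {y = y} zs =
  cong suc (length-remove₁ zs u′ (∈-tail x∈ (≢-sym x≢z)) (Unique[x∷xs]⇒x∉xs u))
... | no x≢z | no y≢z rewrite remove-keep zs (≢-sym x≢z) (≢-sym y≢z) =
  cong suc (length-remove zs u′ (∈-tail x∈ (≢-sym x≢z)) (∈-tail y∈ (≢-sym y≢z)) x≢y)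

∈-raise : ∀ {p} {z : Fin m} {zs} → z ∈ zs → z ∈ raise p zs
∈-raise {p = x , y} {z = z} z∈ with z ≟ x | z ≟ y
... | yes refl | _        = here refl
... | no _     | yes refl = there (here refl)
... | no z≢x   | no z≢y   = there (there (∈-remove⁺ z∈ z≢x z≢y))

raise-unique : ∀ {x y : Fin m} {zs} → x ≢ y → Unique zs → Unique (raise (x , y) zs)
raise-unique {x = x} {y = y} {zs = zs} x≢y u =
  (x≢y ∷ All.tabulate (λ z∈ x≡z → proj₁ (proj₂ (∈-remove⁻ {zs = zs} z∈)) (sym x≡z)))
  ∷ All.tabulate (λ z∈ y≡z → proj₂ (proj₂ (∈-remove⁻ {zs = zs} z∈)) (sym y≡z))
  ∷ filter⁺ (avoids? x y) u

map-remove : (f : Fin m → Fin m′) {x y : Fin m} (zs : List (Fin m)) →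
             (∀ {z} → z ∈ zs → f z ≡ f x → z ≡ x) → (∀ {z} → z ∈ zs → f z ≡ f y → z ≡ y) →
             map f (remove x y zs) ≡ remove (f x) (f y) (map f zs)
map-remove f [] _ _ = refl
map-remove f {x = x} {y = y} (z ∷ zs) inj-x inj-y with x ≟ z | y ≟ z
... | yes refl | _ rewrite remove-drop₁ {x = x} {y = y} zs | remove-drop₁ {x = f x} {y = f y} (map f zs) =
  map-remove f zs (λ z∈ → inj-x (there z∈)) (λ z∈ → inj-y (there z∈))
... | no _ | yes refl rewrite remove-drop₂ {x = x} {y = y} zs | remove-drop₂ {x = f x} {y = f y} (map f zs) =
  map-remove f zs (λ z∈ → inj-x (there z∈)) (λ z∈ → inj-y (there z∈))
... | no x≢z | no y≢z
  rewrite remove-keep zs (≢-sym x≢z) (≢-sym y≢z)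
        | remove-keep {x = f x} {y = f y} {z = f z} (map f zs) (λ e → x≢z (sym (inj-x (here refl) e)))
                                                   (λ e → y≢z (sym (inj-y (here refl) e))) =
  cong (f z ∷_) (map-remove f zs (λ z∈ → inj-x (there z∈)) (λ z∈ → inj-y (there z∈)))

∈-restack : ∀ (P : List (Pair m)) {z zs} → z ∈ zs → z ∈ restack P zs
∈-restack []      z∈ = z∈
∈-restack (p ∷ P) z∈ = ∈-raise (∈-restack P z∈)

restack-split : ∀ (P : List (Pair m)) zs → restack P zs ≡ firstSeen P ++ untouched P zs
restack-split []            zs = refl
restack-split ((x , y) ∷ P) zs =
  trans (cong (raise (x , y)) (restack-split P zs))
        (cong (λ t → x ∷ y ∷ t) (filter-++ (avoids? x y) (firstSeen P) (untouched P zs)))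

restack-preserves : ∀ (P : List (Pair m)) zs → Loopless P → Unique zs → (∀ z → z ∈ zs) →
                    Unique (restack P zs) × length (restack P zs) ≡ length zs
restack-preserves []            zs _        u all = u , refl
restack-preserves ((x , y) ∷ P) zs (d ∷ ds) u all with restack-preserves P zs ds u all
... | u′ , len = raise-unique d u′ ,
    trans (length-remove (restack P zs) u′ (∈-restack P (all x)) (∈-restack P (all y)) d) len

firstSeen-incident : ∀ {z : Fin m} P → z ∈ firstSeen P → Incident z P
firstSeen-incident ((x , y) ∷ P) (here refl)         = here (inj₁ refl)
firstSeen-incident ((x , y) ∷ P) (there (here refl)) = here (inj₂ refl)
firstSeen-incident ((x , y) ∷ P) (there (there z∈))  =
  there (firstSeen-incident P (proj₁ (∈-remove⁻ z∈)))

incident-firstSeen : ∀ {z : Fin m} P → Incident z P → z ∈ firstSeen P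
incident-firstSeen ((x , y) ∷ P) (here (inj₁ refl)) = here refl
incident-firstSeen ((x , y) ∷ P) (here (inj₂ refl)) = there (here refl)
incident-firstSeen (p ∷ P)       (there z∈)         = ∈-raise (incident-firstSeen P z∈)

firstSeen-unique : ∀ (P : List (Pair m)) → Loopless P → Unique (firstSeen P)
firstSeen-unique []      []         = []
firstSeen-unique (p ∷ P) (d ∷ ds) = raise-unique d (firstSeen-unique P ds)

map-firstSeen : (f : Fin m → Fin m′) (P : List (Pair m)) →
                (∀ {z w} → z ∈ firstSeen P → w ∈ firstSeen P → f z ≡ f w → z ≡ w) →
                firstSeen (map (mapPair f) P) ≡ map f (firstSeen P)
map-firstSeen f []            inj = refl
map-firstSeen f ((x , y) ∷ P) inj =
  cong (λ t → f x ∷ f y ∷ t)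
    (trans (cong (remove (f x) (f y)) (map-firstSeen f P (λ z∈ w∈ → inj (∈-raise z∈) (∈-raise w∈))))
           (sym (map-remove f (firstSeen P) (λ z∈ → inj (∈-raise z∈) (here refl))
                                            (λ z∈ → inj (∈-raise z∈) (there (here refl))))))

untouched-∉-firstSeen : ∀ {z} (P : List (Pair m)) zs → z ∈ untouched P zs → z ∉ firstSeen P
untouched-∉-firstSeen ((x , y) ∷ P) zs z∈ (here refl) =
  proj₁ (proj₂ (∈-remove⁻ {zs = untouched P zs} z∈)) refl
untouched-∉-firstSeen ((x , y) ∷ P) zs z∈ (there (here refl)) =
  proj₂ (proj₂ (∈-remove⁻ {zs = untouched P zs} z∈)) refl
untouched-∉-firstSeen ((x , y) ∷ P) zs z∈ (there (there z∈′)) =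
  untouched-∉-firstSeen P zs (proj₁ (∈-remove⁻ z∈)) (proj₁ (∈-remove⁻ z∈′))

untouched-[] : ∀ (P : List (Pair m)) → untouched P [] ≡ []
untouched-[] []      = refl
untouched-[] (p ∷ P) = cong (remove (proj₁ p) (proj₂ p)) (untouched-[] P)

untouched-keep : ∀ (P : List (Pair m)) {z zs} → z ∉ firstSeen P → untouched P (z ∷ zs) ≡ z ∷ untouched P zs
untouched-keep []            z∉ = refl
untouched-keep ((x , y) ∷ P) z∉ =
  trans (cong (remove x y) (untouched-keep P (λ z∈ → z∉ (∈-raise z∈))))
        (remove-keep _ (λ e → z∉ (here e)) (λ e → z∉ (there (here e))))

untouched-drop : ∀ (P : List (Pair m)) {z zs} → z ∈ firstSeen P → untouched P (z ∷ zs) ≡ untouched P zs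
untouched-drop ((x , y) ∷ P) {z} {zs} z∈ with z ∈? firstSeen P
... | yes z∈P = cong (remove x y) (untouched-drop P z∈P)
... | no  z∉P = trans (cong (remove x y) (untouched-keep P z∉P)) (drop-raised z∈)
  where
  drop-raised : z ∈ raise (x , y) (firstSeen P) → remove x y (z ∷ untouched P zs) ≡ remove x y (untouched P zs)
  drop-raised (here refl)         = remove-drop₁ {x = x} {y = y} (untouched P zs)
  drop-raised (there (here refl)) = remove-drop₂ {x = x} {y = y} (untouched P zs)
  drop-raised (there (there z∈′)) = ⊥-elim (z∉P (proj₁ (∈-remove⁻ z∈′)))

untouched-filter : ∀ (P : List (Pair m)) zs {R : Fin m → Set} (R? : Decidable R) →
                   (∀ {z} → z ∈ zs → (R z → z ∉ firstSeen P) × (z ∉ firstSeen P → R z)) →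
                   untouched P zs ≡ filter R? zs
untouched-filter P []       R? _ = untouched-[] P
untouched-filter P (z ∷ zs) R? R⇔∉ with z ∈? firstSeen P
... | yes z∈ = trans (untouched-drop P z∈)
        (trans (untouched-filter P zs R? (λ z∈′ → R⇔∉ (there z∈′)))
               (sym (filter-reject R? (λ r → proj₁ (R⇔∉ (here refl)) r z∈))))
... | no z∉ = trans (untouched-keep P z∉)
        (trans (cong (z ∷_) (untouched-filter P zs R? (λ z∈′ → R⇔∉ (there z∈′))))
               (sym (filter-accept R? (proj₂ (R⇔∉ (here refl)) z∉))))

-- Consecutive ranges of natural numbers and positions in lists.

range : ℕ → ℕ → List ℕ
range a zero    = []
range a (suc m) = a ∷ range (suc a) m

map-suc-range : ∀ a m → map suc (range a m) ≡ range (suc a) m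
map-suc-range a zero    = refl
map-suc-range a (suc m) = cong (suc a ∷_) (map-suc-range (suc a) m)

map-toℕ-tabulate : ∀ n a (f : Fin n → Fin m) → (∀ i → toℕ (f i) ≡ a + toℕ i) →
                   map toℕ (tabulate f) ≡ range a n
map-toℕ-tabulate zero    a f f≗ = refl
map-toℕ-tabulate (suc n) a f f≗ =
  cong₂ _∷_ (trans (f≗ zero) (+-identityʳ a))
            (map-toℕ-tabulate n (suc a) (f ∘ suc) (λ i → trans (f≗ (suc i)) (+-suc a (toℕ i))))

map-toℕ-allFin : ∀ b → map toℕ (allFin b) ≡ range 0 b
map-toℕ-allFin b = map-toℕ-tabulate b 0 id (λ _ → refl)

length-range : ∀ a m → length (range a m) ≡ m
length-range a zero    = refl
length-range a (suc m) = cong suc (length-range (suc a) m)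

range-++ : ∀ a m m′ → range a m ++ range (a + m) m′ ≡ range a (m + m′)
range-++ a zero    m′ = cong (λ t → range t m′) (+-identityʳ a)
range-++ a (suc m) m′ =
  cong (a ∷_) (trans (cong (λ t → range (suc a) m ++ range t m′) (+-suc a m)) (range-++ (suc a) m m′))

drop-range : ∀ a m i → drop i (range a m) ≡ range (a + i) (m ∸ i)
drop-range a m       zero    = cong (λ t → range t m) (sym (+-identityʳ a))
drop-range a zero    (suc i) = refl
drop-range a (suc m) (suc i) = trans (drop-range (suc a) m i) (cong (λ t → range t (m ∸ i)) (sym (+-suc a i)))

prefix-range : ∀ (xs ys : List ℕ) a m → xs ++ ys ≡ range a m → xs ≡ range a (length xs)
prefix-range []       ys a m       e = refl
prefix-range (x ∷ xs) ys a (suc m) e =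
  cong₂ _∷_ (proj₁ (∷-injective e)) (prefix-range xs ys (suc a) m (proj₂ (∷-injective e)))

∈-range⁻ : ∀ {z} a m → z ∈ range a m → a ≤ z × z < a + m
∈-range⁻ a (suc m) (here refl) = ≤-refl , m<m+n a (s≤s z≤n)
∈-range⁻ {z} a (suc m) (there z∈) with ∈-range⁻ (suc a) m z∈
... | a<z , z<1+a+m = <⇒≤ a<z , subst (z <_) (sym (+-suc a m)) z<1+a+m

∈-range⁺ : ∀ {z} a m → a ≤ z → z < a + m → z ∈ range a m
∈-range⁺ a zero    a≤z z<a+0 = ⊥-elim (<⇒≱ (subst (_ <_) (+-identityʳ a) z<a+0) a≤z)
∈-range⁺ {z} a (suc m) a≤z z<a+1+m with z ≟ℕ a
... | yes refl = here refl
... | no  z≢a  = there (∈-range⁺ (suc a) m (≤∧≢⇒< a≤z (≢-sym z≢a)) (subst (z <_) (+-suc a m) z<a+1+m))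

module _ (xs : List (Fin m)) {a n : ℕ} (xs≈ : map toℕ xs ≡ range a n) where

  ranged⁻ : ∀ {z} → z ∈ xs → a ≤ toℕ z × toℕ z < a + n
  ranged⁻ z∈ = ∈-range⁻ a n (subst (_ ∈_) xs≈ (∈-map⁺ toℕ z∈))

  ranged⁺ : ∀ z → a ≤ toℕ z → toℕ z < a + n → z ∈ xs
  ranged⁺ z a≤z z<a+n with ∈-map⁻ toℕ (subst (_ ∈_) (sym xs≈) (∈-range⁺ a n a≤z z<a+n))
  ... | w , w∈ , z≡w = subst (_∈ xs) (sym (toℕ-injective z≡w)) w∈

position : List (Fin m) → Fin m → ℕ
position []       v = 0
position (x ∷ xs) v with v ≟ x
... | yes _ = 0
... | no  _ = suc (position xs v)

position-here : ∀ (x : Fin m) xs → position (x ∷ xs) x ≡ 0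
position-here x xs with x ≟ x
... | yes _   = refl
... | no  x≢x = ⊥-elim (x≢x refl)

position-there : ∀ (x v : Fin m) xs → v ≢ x → position (x ∷ xs) v ≡ suc (position xs v)
position-there x v xs v≢x with v ≟ x
... | yes v≡x = ⊥-elim (v≢x v≡x)
... | no  _   = refl

position-< : ∀ (xs : List (Fin m)) {v} → v ∈ xs → position xs v < length xs
position-< (x ∷ xs) {v} v∈ with v ≟ x
... | yes _   = s≤s z≤n
... | no  v≢x = s≤s (position-< xs (∈-tail v∈ (≢-sym v≢x)))

nth-∈ : ∀ {A : Set} (xs : List A) d {i} → i < length xs → nth d xs i ∈ xs
nth-∈ (x ∷ xs) d {zero}  _         = here refl
nth-∈ (x ∷ xs) d {suc i} (s≤s i<) = there (nth-∈ xs d i<)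

nth-position : ∀ (xs : List (Fin m)) d {v} → v ∈ xs → nth d xs (position xs v) ≡ v
nth-position (x ∷ xs) d {v} v∈ with v ≟ x
... | yes v≡x = sym v≡x
... | no  v≢x = nth-position xs d (∈-tail v∈ (≢-sym v≢x))

position-nth : ∀ (xs : List (Fin m)) d → Unique xs → ∀ {i} → i < length xs → position xs (nth d xs i) ≡ i
position-nth (x ∷ xs) d _          {zero}  _        = position-here x xs
position-nth (x ∷ xs) d (x∉ ∷ u) {suc i} (s≤s i<) =
  trans (position-there x _ xs (λ e → All.lookup x∉ (nth-∈ xs d i<) (sym e)))
        (cong suc (position-nth xs d u i<))

position-injective : ∀ (xs : List (Fin m)) {v w} → v ∈ xs → w ∈ xs → position xs v ≡ position xs w → v ≡ w
position-injective xs {v} v∈ w∈ e =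
  trans (sym (nth-position xs v v∈)) (trans (cong (nth v xs) e) (nth-position xs v w∈))

map-position : ∀ (xs : List (Fin m)) → Unique xs → map (position xs) xs ≡ range 0 (length xs)
map-position []       _          = refl
map-position (x ∷ xs) (x∉ ∷ u) =
  cong₂ _∷_ (position-here x xs)
    (trans (shift xs x∉)
           (trans (map-∘ xs) (trans (cong (map suc) (map-position xs u)) (map-suc-range 0 (length xs)))))
  where
  shift : ∀ ys → All (x ≢_) ys → map (position (x ∷ xs)) ys ≡ map (suc ∘ position xs) ys
  shift []       _          = refl
  shift (y ∷ ys) (x≢y ∷ ps) = cong₂ _∷_ (position-there x y xs (≢-sym x≢y)) (shift ys ps)

position-map : (f : Fin m → Fin m′) → Injective _≡_ _≡_ f →
               ∀ xs v → position (map f xs) (f v) ≡ position xs v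
position-map f f-inj []       v = refl
position-map f f-inj (x ∷ xs) v with v ≟ x
... | yes refl = position-here (f v) (map f xs)
... | no  v≢x  = trans (position-there (f x) (f v) (map f xs) (λ e → v≢x (f-inj e)))
                       (cong suc (position-map f f-inj xs v))

position-ranged : ∀ (xs : List (Fin m)) a n → map toℕ xs ≡ range a n →
                  ∀ {z} → z ∈ xs → a + position xs z ≡ toℕ z
position-ranged (x ∷ xs) a (suc n) e {z} z∈ with z ≟ x | ∷-injective e
... | yes refl | x≡a , _   = trans (+-identityʳ a) (sym x≡a)
... | no  z≢x  | _   , xs≈ =
  trans (+-suc a _) (position-ranged xs (suc a) n xs≈ (∈-tail z∈ (≢-sym z≢x)))

-- A single card as an operation on the list of levels.

tabulate-nth : ∀ {A : Set} (xs : List A) {n} → length xs ≡ n → (d : Fin n → A) →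
               tabulate (λ i → nth (d i) xs (toℕ i)) ≡ xs
tabulate-nth []       {zero}  _   d = refl
tabulate-nth (x ∷ xs) {suc n} len d = cong (x ∷_) (tabulate-nth xs (suc-injective len) (d ∘ suc))

πC-table : ∀ {b} (c : Card b) → ValidCard c → map (πC c) (allFin b) ≡ raise c (allFin b)
πC-table {zero}        (() , _)
πC-table {suc zero}    (zero , zero) s₁≢s₂ = ⊥-elim (s₁≢s₂ refl)
πC-table {suc (suc b)} (s₁ , s₂) s₁≢s₂ =
  trans (map-tabulate id (πC (s₁ , s₂)))
        (cong (λ t → s₁ ∷ s₂ ∷ t) (tabulate-nth (complement (s₁ , s₂)) length-complement (λ i → suc (suc i))))
  where
  length-complement : length (complement (s₁ , s₂)) ≡ b
  length-complement = suc-injective (suc-injective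
    (trans (length-remove (allFin (suc (suc b))) (allFin⁺ _) (∈-allFin s₁) (∈-allFin s₂) s₁≢s₂)
           (length-tabulate id)))

map-unique⇒injective : ∀ {A B : Set} (f : A → B) {xs : List A} → Unique (map f xs) →
                       ∀ {x y} → x ∈ xs → y ∈ xs → f x ≡ f y → x ≡ y
map-unique⇒injective f (_ ∷ _)  (here refl) (here refl) _ = refl
map-unique⇒injective f (fx∉ ∷ _) (here refl) (there y∈)  e = ⊥-elim (All.lookup fx∉ (∈-map⁺ f y∈) e)
map-unique⇒injective f (fx∉ ∷ _) (there x∈) (here refl)  e = ⊥-elim (All.lookup fx∉ (∈-map⁺ f x∈) (sym e))
map-unique⇒injective f (_ ∷ u)   (there x∈) (there y∈)   e = map-unique⇒injective f u x∈ y∈ e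

πC-injective : ∀ {b} (c : Card b) → ValidCard c → Injective _≡_ _≡_ (πC c)
πC-injective {b} c valid =
  map-unique⇒injective (πC c)
    (subst Unique (sym (πC-table c valid)) (raise-unique valid (allFin⁺ b)))
    (∈-allFin _) (∈-allFin _)

finalPos-injective : ∀ {b} (cs : List (Card b)) → All ValidCard cs → Injective _≡_ _≡_ (finalPos cs)
finalPos-injective []       _            e = e
finalPos-injective (c ∷ cs) (valid ∷ vs) e = πC-injective c valid (finalPos-injective cs vs e)

-- Reading a card sequence backwards.  F labels the final levels by balls
-- (F = σ⁻¹ in the theorem, so that every ball carries its own name).

ballAt : ∀ {b} → List (Card b) → (Fin b → Fin b) → Fin b → Fin b
ballAt cs F p = F (finalPos cs p)

thrownPairs : ∀ {b n} → Vec (Card b) n → (Fin b → Fin b) → Vec (Pair b) n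
thrownPairs []              F = []
thrownPairs ((s₁ , s₂) ∷ A) F = (ballAt (toList A) F s₁ , ballAt (toList A) F s₂) ∷ thrownPairs A F

module _ {b : ℕ} {F : Fin b → Fin b} (F-inj : Injective _≡_ _≡_ F) where
  open ≡-Reasoning

  ballAt-injective : ∀ cs → All ValidCard cs → Injective _≡_ _≡_ (ballAt cs F)
  ballAt-injective cs valid e = finalPos-injective cs valid (F-inj e)

  thrownPairs-loopless : ∀ {n} (A : Vec (Card b) n) → All ValidCard (toList A) →
                         Loopless (toList (thrownPairs A F))
  thrownPairs-loopless []              _              = []
  thrownPairs-loopless ((s₁ , s₂) ∷ A) (valid ∷ vs) =
    (λ e → valid (ballAt-injective (toList A) vs e)) ∷ thrownPairs-loopless A vs

  arrangement-before-card : (T : Fin b → Fin b) → Injective _≡_ _≡_ T → (c : Card b) → ValidCard c →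
                            map (T ∘ πC c) (allFin b) ≡ raise (T (proj₁ c) , T (proj₂ c)) (map T (allFin b))
  arrangement-before-card T T-inj c valid = begin
    map (T ∘ πC c) (allFin b)               ≡⟨ map-∘ (allFin b) ⟩
    map T (map (πC c) (allFin b))           ≡⟨ cong (map T) (πC-table c valid) ⟩
    map T (raise c (allFin b))              ≡⟨ cong (λ t → T (proj₁ c) ∷ T (proj₂ c) ∷ t)
                                                 (map-remove T (allFin b) (λ _ → T-inj) (λ _ → T-inj)) ⟩
    raise (T (proj₁ c) , T (proj₂ c)) (map T (allFin b)) ∎

  arrangement-before : ∀ {n} (A : Vec (Card b) n) → All ValidCard (toList A) →
                       map (ballAt (toList A) F) (allFin b) ≡ restack (toList (thrownPairs A F)) (map F (allFin b))
  arrangement-before []              _            = refl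
  arrangement-before ((s₁ , s₂) ∷ A) (valid ∷ vs) =
    trans (arrangement-before-card (ballAt (toList A) F) (ballAt-injective (toList A) vs) (s₁ , s₂) valid)
          (cong (raise _) (arrangement-before A vs))

  thrown-iff : ∀ {n} (A : Vec (Card b) n) → All ValidCard (toList A) → ∀ p →
               (thrownFrom (toList A) p ≡ true → ballAt (toList A) F p ∈ firstSeen (toList (thrownPairs A F))) ×
               (ballAt (toList A) F p ∈ firstSeen (toList (thrownPairs A F)) → thrownFrom (toList A) p ≡ true)
  thrown-iff []              _            p                = (λ ()) , (λ ())
  thrown-iff ((s₁ , s₂) ∷ A) _            zero             = (λ _ → here refl) , (λ _ → refl)
  thrown-iff ((s₁ , s₂) ∷ A) _            (suc zero)       = (λ _ → there (here refl)) , (λ _ → refl)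
  thrown-iff ((s₁ , s₂) ∷ A) (valid ∷ vs) p@(suc (suc _)) =
    (λ t → ∈-raise (proj₁ ih t)) , (λ p∈ → proj₂ ih (not-raised p∈))
    where
    q = πC (s₁ , s₂) p
    seen = firstSeen (toList (thrownPairs A F))
    ih : (thrownFrom (toList A) q ≡ true → ballAt (toList A) F q ∈ seen) ×
         (ballAt (toList A) F q ∈ seen → thrownFrom (toList A) q ≡ true)
    ih = thrown-iff A vs q
    ballAt-inj : Injective _≡_ _≡_ (ballAt (toList ((s₁ , s₂) ∷ A)) F)
    ballAt-inj = ballAt-injective (toList ((s₁ , s₂) ∷ A)) (valid ∷ vs)
    -- the ball at level p ≥ 3 is not one of the two balls thrown at this card
    not-raised : ballAt (toList ((s₁ , s₂) ∷ A)) F p ∈ raise _ seen → ballAt (toList A) F q ∈ seen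
    not-raised (here e) with ballAt-inj {p} {zero} e
    ... | ()
    not-raised (there (here e)) with ballAt-inj {p} {suc zero} e
    ... | ()
    not-raised (there (there p∈)) = proj₁ (∈-remove⁻ p∈)

  -- When every ball carries its own name, the arrangement before the cards
  -- is 0, …, b-1; hence the thrown balls are the entries of the thrown pairs
  -- and they are exactly the first few balls 0, …, t-1.
  module Named {n} (A : Vec (Card b) n) (valid : All ValidCard (toList A))
               (named : ∀ j → ballAt (toList A) F j ≡ j) where

    private
      P : List (Pair b)
      P = toList (thrownPairs A F)

    allFin-split : allFin b ≡ firstSeen P ++ untouched P (map F (allFin b))
    allFin-split = begin
      allFin b                                   ≡⟨ sym (map-id (allFin b)) ⟩
      map id (allFin b)                          ≡⟨ sym (map-cong named (allFin b)) ⟩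
      map (ballAt (toList A) F) (allFin b)       ≡⟨ arrangement-before A valid ⟩
      restack P (map F (allFin b))               ≡⟨ restack-split P (map F (allFin b)) ⟩
      firstSeen P ++ untouched P (map F (allFin b)) ∎

    numThrown-firstSeen : numThrown A ≡ length (firstSeen P)
    numThrown-firstSeen = begin
      length (filter thrown? (allFin b))
        ≡⟨ cong (length ∘ filter thrown?) allFin-split ⟩
      length (filter thrown? (firstSeen P ++ U))
        ≡⟨ cong length (filter-++ thrown? (firstSeen P) U) ⟩
      length (filter thrown? (firstSeen P) ++ filter thrown? U)
        ≡⟨ cong₂ (λ s t → length (s ++ t)) (filter-all thrown? (All.tabulate thrown-of-seen))
                                            (filter-none thrown? (All.tabulate unthrown-of-untouched)) ⟩
      length (firstSeen P ++ [])
        ≡⟨ cong length (++-identityʳ (firstSeen P)) ⟩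
      length (firstSeen P) ∎
      where
      U : List (Fin b)
      U = untouched P (map F (allFin b))
      thrown? : ∀ j → Dec (thrownFrom (toList A) j ≡ true)
      thrown? j = thrownFrom (toList A) j ≟𝔹 true
      thrown-of-seen : ∀ {j} → j ∈ firstSeen P → thrownFrom (toList A) j ≡ true
      thrown-of-seen {j} j∈ = proj₂ (thrown-iff A valid j) (subst (_∈ firstSeen P) (sym (named j)) j∈)
      unthrown-of-untouched : ∀ {j} → j ∈ U → thrownFrom (toList A) j ≢ true
      unthrown-of-untouched {j} j∈ t =
        untouched-∉-firstSeen P _ j∈ (subst (_∈ firstSeen P) (named j) (proj₁ (thrown-iff A valid j) t))

    firstSeen-initial : map toℕ (firstSeen P) ≡ range 0 (length (firstSeen P))
    firstSeen-initial = trans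
      (prefix-range (map toℕ (firstSeen P)) (map toℕ (untouched P (map F (allFin b)))) 0 b
        (trans (sym (map-++ toℕ (firstSeen P) _)) (trans (cong (map toℕ) (sym allFin-split)) (map-toℕ-allFin b))))
      (cong (range 0) (length-map toℕ (firstSeen P)))

-- Reconstructing the cards from the thrown pairs.

preimage : ∀ {b} → (Fin b → Fin b) → Fin b → Fin b
preimage T x with anyFin? (λ i → T i ≟ x)
... | yes (i , _) = i
... | no  _       = x

preimage-correct : ∀ {b} (T : Fin b → Fin b) x → (∃ λ i → T i ≡ x) → T (preimage T x) ≡ x
preimage-correct T x has-preimage with anyFin? (λ i → T i ≟ x)
... | yes (_ , Ti≡x) = Ti≡x
... | no  none       = ⊥-elim (none has-preimage)

-- cards throwing the given pairs: each card sends the two thrown balls to the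
-- levels where the later cards expect them
cardsFor : ∀ {b n} → (Fin b → Fin b) → Vec (Pair b) n → Vec (Card b) n
cardsFor     F []            = []
cardsFor {b} F ((x , y) ∷ Q) = (preimage T x , preimage T y) ∷ cardsFor F Q
  where
  T : Fin b → Fin b
  T = ballAt (toList (cardsFor F Q)) F

module _ {b : ℕ} {F : Fin b → Fin b} (F-inj : Injective _≡_ _≡_ F) (F-onto : ∀ z → ∃ λ i → F i ≡ z) where

  ballAt-onto : ∀ {n} (A : Vec (Card b) n) → All ValidCard (toList A) → ∀ z → ∃ λ p → ballAt (toList A) F p ≡ z
  ballAt-onto A valid z with ∈-map⁻ (ballAt (toList A) F) z∈before
    where
    z∈final : z ∈ map F (allFin b)
    z∈final = subst (_∈ map F (allFin b)) (proj₂ (F-onto z)) (∈-map⁺ F (∈-allFin (proj₁ (F-onto z))))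
    z∈before : z ∈ map (ballAt (toList A) F) (allFin b)
    z∈before = subst (z ∈_) (sym (arrangement-before F-inj A valid)) (∈-restack (toList (thrownPairs A F)) z∈final)
  ... | p , _ , z≡ = p , sym z≡

  cardsFor-correct : ∀ {n} (Q : Vec (Pair b) n) → Loopless (toList Q) →
                     All ValidCard (toList (cardsFor F Q)) × thrownPairs (cardsFor F Q) F ≡ Q
  cardsFor-correct []            _          = [] , refl
  cardsFor-correct ((x , y) ∷ Q) (x≢y ∷ ds) with cardsFor-correct Q ds
  ... | valid , thrown≡Q = (card-valid ∷ valid) , cong₂ _∷_ (cong₂ _,_ at-x at-y) thrown≡Q
    where
    T : Fin b → Fin b
    T = ballAt (toList (cardsFor F Q)) F
    at-x : T (preimage T x) ≡ x
    at-x = preimage-correct T x (ballAt-onto (cardsFor F Q) valid x)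
    at-y : T (preimage T y) ≡ y
    at-y = preimage-correct T y (ballAt-onto (cardsFor F Q) valid y)
    card-valid : preimage T x ≢ preimage T y
    card-valid e = x≢y (trans (sym at-x) (trans (cong T e) at-y))

  cardsFor-thrownPairs : ∀ {n} (A : Vec (Card b) n) → All ValidCard (toList A) → cardsFor F (thrownPairs A F) ≡ A
  cardsFor-thrownPairs []              _            = refl
  cardsFor-thrownPairs ((s₁ , s₂) ∷ A) (valid ∷ vs) rewrite cardsFor-thrownPairs A vs =
    cong₂ _∷_ (cong₂ _,_ (T-inj (preimage-correct T _ (s₁ , refl))) (T-inj (preimage-correct T _ (s₂ , refl)))) refl
    where
    T : Fin b → Fin b
    T = ballAt (toList A) F
    T-inj : Injective _≡_ _≡_ T
    T-inj = ballAt-injective F-inj (toList A) vs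

module _ {A : Set} {_≺_ : A → A → Set}
         (≺-irrefl : ∀ {x y} → x ≡ y → ¬ (x ≺ y)) (≺-trans : Transitive _≺_) where

  sorted-unique : ∀ {xs ys} → AllPairs _≺_ xs → AllPairs _≺_ ys →
                  (∀ {z} → z ∈ xs → z ∈ ys) → (∀ {z} → z ∈ ys → z ∈ xs) → xs ≡ ys
  sorted-unique {[]}     {[]}     _ _ _ _ = refl
  sorted-unique {[]}     {y ∷ ys} _ _ _ ⊇ with ⊇ (here refl)
  ... | ()
  sorted-unique {x ∷ xs} {[]}     _ _ ⊆ _ with ⊆ (here refl)
  ... | ()
  sorted-unique {x ∷ xs} {y ∷ ys} (x≺xs ∷ sxs) (y≺ys ∷ sys) ⊆ ⊇ =
    cong₂ _∷_ x≡y (sorted-unique sxs sys ⊆′ ⊇′)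
    where
    x≡y : x ≡ y
    x≡y with ⊆ (here refl) | ⊇ (here refl)
    ... | here x≡y′  | _          = x≡y′
    ... | there _    | here y≡x   = sym y≡x
    ... | there x∈ys | there y∈xs =
      ⊥-elim (≺-irrefl refl (≺-trans (All.lookup x≺xs y∈xs) (All.lookup y≺ys x∈ys)))
    ⊆′ : ∀ {z} → z ∈ xs → z ∈ ys
    ⊆′ z∈ = ∈-tail (⊆ (there z∈)) (λ y≡z → ≺-irrefl (trans x≡y y≡z) (All.lookup x≺xs z∈))
    ⊇′ : ∀ {z} → z ∈ ys → z ∈ xs
    ⊇′ z∈ = ∈-tail (⊇ (there z∈)) (λ x≡z → ≺-irrefl (trans (sym x≡y) x≡z) (All.lookup y≺ys z∈))

  filter-sorted : ∀ {R : A → Set} (R? : Decidable R) {xs ys} → AllPairs _≺_ xs → AllPairs _≺_ ys →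
                  (∀ {z} → z ∈ ys → z ∈ xs) → (∀ {z} → z ∈ xs → (R z → z ∈ ys) × (z ∈ ys → R z)) →
                  filter R? xs ≡ ys
  filter-sorted R? sxs sys ys⊆xs R⇔∈ = sorted-unique (AllPairsP.filter⁺ R? sxs) sys
    (λ z∈ → let z∈xs , Rz = ∈-filter⁻ R? z∈ in proj₁ (R⇔∈ z∈xs) Rz)
    (λ z∈ → ∈-filter⁺ R? (ys⊆xs z∈) (proj₂ (R⇔∈ (ys⊆xs z∈)) z∈))

filter-map : ∀ {A B : Set} {R : B → Set} (R? : Decidable R) (f : A → B) xs →
             filter R? (map f xs) ≡ map f (filter (R? ∘ f) xs)
filter-map R? f []       = refl
filter-map R? f (x ∷ xs) with R? (f x)
... | yes _ = cong (f x ∷_) (filter-map R? f xs)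
... | no  _ = filter-map R? f xs

reverse-allPairs : ∀ {A : Set} {R : A → A → Set} (xs : List A) → AllPairs R xs → AllPairs (flip R) (reverse xs)
reverse-allPairs []       []         = []
reverse-allPairs {R = R} (x ∷ xs) (x~xs ∷ rxs) =
  subst (AllPairs (flip R)) (sym (unfold-reverse x xs))
    (AllPairsP.++⁺ (reverse-allPairs xs rxs) ([] ∷ [])
       (All.tabulate (λ y∈ → All.lookup x~xs (AnyP.reverse⁻ y∈) ∷ [])))

-- Strictly decreasing prefixes, the quantity behind L(σ).

decRun-sound : ∀ x (ys zs : List ℕ) → length ys ≤ decRun x (ys ++ zs) → All (_< x) ys × AllPairs _>_ ys
decRun-sound x []       zs _ = [] , []
decRun-sound x (y ∷ ys) zs len with y <ᵇ x in y<ᵇx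
decRun-sound x (y ∷ ys) zs (s≤s len) | true with decRun-sound y ys zs len
... | ys<y , dec = (y<x ∷ All.map (λ z<y → <-trans z<y y<x) ys<y) , (ys<y ∷ dec)
  where
  y<x : y < x
  y<x = <ᵇ⇒< y x (subst True (sym y<ᵇx) _)
decRun-sound x (y ∷ ys) zs () | false

decPrefix-sound : ∀ (ys zs : List ℕ) → length ys ≤ decPrefix (ys ++ zs) → AllPairs _>_ ys
decPrefix-sound []       zs _         = []
decPrefix-sound (y ∷ ys) zs (s≤s len) = let ys<y , dec = decRun-sound y ys zs len in ys<y ∷ dec

∸-swap : ∀ b l k → b ∸ l ≤ k → b ∸ k ≤ l
∸-swap b l k b∸l≤k = m≤n+o⇒m∸n≤o b k (begin
  b            ≤⟨ m≤n+m∸n b l ⟩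
  l + (b ∸ l)  ≤⟨ +-monoʳ-≤ l b∸l≤k ⟩
  l + k        ≡⟨ +-comm l k ⟩
  k + l        ∎)
  where open ≤-Reasoning

-- The hypothesis b - L(σ) ≤ k: apart from the first k balls, the balls
-- already stand in the order σ⁻¹ puts them in.

module UpperLevels {b k : ℕ} (σ : Permutation′ b) (k≤b : k ≤ b) (L-bound : b ∸ L σ ≤ k) where
  open ≡-Reasoning

  σ⁻¹ : Fin b → Fin b
  σ⁻¹ l = σ ⟨$⟩ˡ l

  upper : List (Fin b)
  upper = drop k (allFin b)

  map-toℕ-upper : map toℕ upper ≡ range k (b ∸ k)
  map-toℕ-upper = begin
    map toℕ (drop k (allFin b))  ≡⟨ sym (drop-map k (allFin b)) ⟩
    drop k (map toℕ (allFin b))  ≡⟨ cong (drop k) (map-toℕ-allFin b) ⟩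
    drop k (range 0 b)           ≡⟨ drop-range 0 b k ⟩
    range k (b ∸ k)              ∎

  ∈-upper⁻ : ∀ {z} → z ∈ upper → k ≤ toℕ z
  ∈-upper⁻ z∈ = proj₁ (ranged⁻ upper map-toℕ-upper z∈)

  ∈-upper⁺ : ∀ z → k ≤ toℕ z → z ∈ upper
  ∈-upper⁺ z k≤z = ranged⁺ upper map-toℕ-upper z k≤z (subst (toℕ z <_) (sym (m+[n∸m]≡n k≤b)) (toℕ<n z))

  -- the upper levels lie in the final increasing run of σ
  σ-increasing : AllPairs _<ᶠ_ (map (σ ⟨$⟩ʳ_) upper)
  σ-increasing = AllPairsP.map⁺ (AllPairsP.map⁻ (subst (AllPairs _<_) (drop-map k (allFin b)) increasing))
    where
    values : List ℕ
    values = map (λ j → toℕ (σ ⟨$⟩ʳ j)) (allFin b)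
    run-long-enough : length (reverse (drop k values)) ≤ L σ
    run-long-enough = subst (_≤ L σ) (sym length-upper) (∸-swap b (L σ) k L-bound)
      where
      length-upper : length (reverse (drop k values)) ≡ b ∸ k
      length-upper = begin
        length (reverse (drop k values)) ≡⟨ length-reverse (drop k values) ⟩
        length (drop k values)           ≡⟨ length-drop k values ⟩
        length values ∸ k                ≡⟨ cong (_∸ k) (trans (length-map _ (allFin b)) (length-tabulate id)) ⟩
        b ∸ k                            ∎
    values-split : reverse values ≡ reverse (drop k values) ++ reverse (take k values)
    values-split = trans (cong reverse (sym (take++drop≡id k values))) (reverse-++ (take k values) (drop k values))
    increasing : AllPairs _<_ (drop k values)
    increasing = subst (AllPairs _<_) (reverse-involutive (drop k values))
      (reverse-allPairs (reverse (drop k values))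
        (decPrefix-sound (reverse (drop k values)) (reverse (take k values))
          (subst (λ t → length (reverse (drop k values)) ≤ decPrefix t) values-split run-long-enough)))

  upper-final-levels : filter (λ l → k ≤? toℕ (σ⁻¹ l)) (allFin b) ≡ map (σ ⟨$⟩ʳ_) upper
  upper-final-levels =
    filter-sorted Fin.<-irrefl Fin.<-trans (λ l → k ≤? toℕ (σ⁻¹ l))
      (AllPairsP.tabulate⁺-< id) σ-increasing (λ {l} _ → ∈-allFin l)
      (λ _ → to-upper , from-upper)
    where
    to-upper : ∀ {l} → k ≤ toℕ (σ⁻¹ l) → l ∈ map (σ ⟨$⟩ʳ_) upper
    to-upper {l} k≤ = subst (_∈ map (σ ⟨$⟩ʳ_) upper) (inverseʳ σ) (∈-map⁺ (σ ⟨$⟩ʳ_) (∈-upper⁺ (σ⁻¹ l) k≤))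
    from-upper : ∀ {l} → l ∈ map (σ ⟨$⟩ʳ_) upper → k ≤ toℕ (σ⁻¹ l)
    from-upper l∈ with ∈-map⁻ (σ ⟨$⟩ʳ_) l∈
    ... | z , z∈ , refl = subst (λ t → k ≤ toℕ t) (sym (inverseˡ σ)) (∈-upper⁻ z∈)

  -- if the thrown balls are 0, …, k-1, the balls stood at levels 0, …, b-1 initially
  restack-identity : ∀ P → map toℕ (firstSeen P) ≡ range 0 k → restack P (map σ⁻¹ (allFin b)) ≡ allFin b
  restack-identity P seen≈ = map-injective toℕ-injective (begin
    map toℕ (restack P (map σ⁻¹ (allFin b)))                        ≡⟨ cong (map toℕ) (restack-split P _) ⟩
    map toℕ (firstSeen P ++ untouched P (map σ⁻¹ (allFin b)))        ≡⟨ map-++ toℕ (firstSeen P) _ ⟩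
    map toℕ (firstSeen P) ++ map toℕ (untouched P (map σ⁻¹ (allFin b)))
                                                          ≡⟨ cong₂ _++_ seen≈ (cong (map toℕ) untouched≡upper) ⟩
    range 0 k ++ map toℕ upper                           ≡⟨ cong (range 0 k ++_) map-toℕ-upper ⟩
    range 0 k ++ range k (b ∸ k)                         ≡⟨ range-++ 0 k (b ∸ k) ⟩
    range 0 (k + (b ∸ k))                                ≡⟨ cong (range 0) (m+[n∸m]≡n k≤b) ⟩
    range 0 b                                            ≡⟨ sym (map-toℕ-allFin b) ⟩
    map toℕ (allFin b)                                   ∎)
    where
    untouched≡upper : untouched P (map σ⁻¹ (allFin b)) ≡ upper
    untouched≡upper = begin
      untouched P (map σ⁻¹ (allFin b))
        ≡⟨ untouched-filter P _ (λ z → k ≤? toℕ z)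
             (λ {z} _ → (λ k≤z z∈ → <⇒≱ (proj₂ (ranged⁻ (firstSeen P) seen≈ z∈)) k≤z) ,
                        (λ z∉ → ≮⇒≥ (λ z<k → z∉ (ranged⁺ (firstSeen P) seen≈ z z≤n z<k)))) ⟩
      filter (λ z → k ≤? toℕ z) (map σ⁻¹ (allFin b))
        ≡⟨ filter-map (λ z → k ≤? toℕ z) σ⁻¹ (allFin b) ⟩
      map σ⁻¹ (filter (λ l → k ≤? toℕ (σ⁻¹ l)) (allFin b))
        ≡⟨ cong (map σ⁻¹) upper-final-levels ⟩
      map σ⁻¹ (map (σ ⟨$⟩ʳ_) upper)
        ≡⟨ sym (map-∘ upper) ⟩
      map (σ⁻¹ ∘ (σ ⟨$⟩ʳ_)) upper
        ≡⟨ map-cong (λ _ → inverseˡ σ) upper ⟩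
      map id upper
        ≡⟨ map-id upper ⟩
      upper ∎

-- Standard pair sequences: loopless, with distinct entries 0, 1, …, k-1 in
-- order of first appearance.  They are compared by their entries.

Standard : (b n k : ℕ) → Set
Standard b n k = Σ (Vec (Pair b) n) λ Q → Loopless (toList Q) × map toℕ (firstSeen (toList Q)) ≡ range 0 k

StandardSetoid : (b n k : ℕ) → Setoid 0ℓ 0ℓ
StandardSetoid b n k = On.setoid (≡.setoid (Vec (Pair b) n)) (λ (Q : Standard b n k) → proj₁ Q)

map-fixed : ∀ {A : Set} (f : A → A) (xs : List A) → map f xs ≡ xs → ∀ {x} → x ∈ xs → f x ≡ x
map-fixed f (x ∷ xs) e (here refl) = proj₁ (∷-injective e)
map-fixed f (x ∷ xs) e (there x∈)  = map-fixed f xs (proj₂ (∷-injective e)) x∈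

module CardsAsPairs {b k : ℕ} (σ : Permutation′ b) (k≤b : k ≤ b) (L-bound : b ∸ L σ ≤ k) (n : ℕ) where
  open ≡-Reasoning
  open UpperLevels σ k≤b L-bound using (σ⁻¹; restack-identity)

  σ⁻¹-injective : Injective _≡_ _≡_ σ⁻¹
  σ⁻¹-injective e = trans (sym (inverseʳ σ)) (trans (cong (σ ⟨$⟩ʳ_) e) (inverseʳ σ))

  σ⁻¹-onto : ∀ z → ∃ λ i → σ⁻¹ i ≡ z
  σ⁻¹-onto z = σ ⟨$⟩ʳ z , inverseˡ σ

  toPairs : CardSeq b n k σ → Standard b n k
  toPairs (A , valid , thrown≡k , πA≡σ) =
    thrownPairs A σ⁻¹ , thrownPairs-loopless σ⁻¹-injective A valid′ ,
    subst (λ t → map toℕ (firstSeen (toList (thrownPairs A σ⁻¹))) ≡ range 0 t) length-seen firstSeen-initial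
    where
    valid′ : All ValidCard (toList A)
    valid′ = VAllP.toList⁺ valid
    named : ∀ j → ballAt (toList A) σ⁻¹ j ≡ j
    named j = trans (cong σ⁻¹ (πA≡σ j)) (inverseˡ σ)
    open Named σ⁻¹-injective A valid′ named
    length-seen : length (firstSeen (toList (thrownPairs A σ⁻¹))) ≡ k
    length-seen = trans (sym numThrown-firstSeen) thrown≡k

  -- the cards throwing a standard sequence: by 'restack-identity' they realise σ
  toCards : Standard b n k → CardSeq b n k σ
  toCards (Q , loopless , seen≈) = A , VAllP.toList⁻ valid , thrown≡k , πA≡σ
    where
    A : Vec (Card b) n
    A = cardsFor σ⁻¹ Q
    correct : All ValidCard (toList A) × thrownPairs A σ⁻¹ ≡ Q
    correct = cardsFor-correct σ⁻¹-injective σ⁻¹-onto Q loopless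
    valid : All ValidCard (toList A)
    valid = proj₁ correct
    named : ∀ j → ballAt (toList A) σ⁻¹ j ≡ j
    named j = map-fixed (ballAt (toList A) σ⁻¹) (allFin b) arrangement (∈-allFin j)
      where
      arrangement : map (ballAt (toList A) σ⁻¹) (allFin b) ≡ allFin b
      arrangement = begin
        map (ballAt (toList A) σ⁻¹) (allFin b)                  ≡⟨ arrangement-before σ⁻¹-injective A valid ⟩
        restack (toList (thrownPairs A σ⁻¹)) (map σ⁻¹ (allFin b))
          ≡⟨ cong (λ t → restack (toList t) _) (proj₂ correct) ⟩
        restack (toList Q) (map σ⁻¹ (allFin b))                 ≡⟨ restack-identity (toList Q) seen≈ ⟩
        allFin b                                                ∎
    open Named σ⁻¹-injective A valid named
    πA≡σ : ∀ j → πA A j ≡ σ ⟨$⟩ʳ j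
    πA≡σ j = trans (sym (inverseʳ σ)) (cong (σ ⟨$⟩ʳ_) (named j))
    thrown≡k : numThrown A ≡ k
    thrown≡k = begin
      numThrown A                                      ≡⟨ numThrown-firstSeen ⟩
      length (firstSeen (toList (thrownPairs A σ⁻¹)))  ≡⟨ cong (length ∘ firstSeen ∘ toList) (proj₂ correct) ⟩
      length (firstSeen (toList Q))                    ≡⟨ sym (length-map toℕ (firstSeen (toList Q))) ⟩
      length (map toℕ (firstSeen (toList Q)))          ≡⟨ cong length seen≈ ⟩
      length (range 0 k)                               ≡⟨ length-range 0 k ⟩
      k                                                ∎

  pairs↔cards : Inverse (StandardSetoid b n k) (CardSeqSetoid b n k σ)
  pairs↔cards = record
    { to        = toCards
    ; from      = toPairs
    ; to-cong   = cong (cardsFor σ⁻¹)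
    ; from-cong = cong (λ A → thrownPairs A σ⁻¹)
    ; inverse   = (λ {A} {Q} Q≡ → trans (cong (cardsFor σ⁻¹) Q≡) (recover-cards A))
                , (λ {Q} {A} A≡ → trans (cong (λ A → thrownPairs A σ⁻¹) A≡) (recover-pairs Q))
    }
    where
    recover-pairs : ∀ (Q : Standard b n k) → thrownPairs (cardsFor σ⁻¹ (proj₁ Q)) σ⁻¹ ≡ proj₁ Q
    recover-pairs (Q , loopless , _) = proj₂ (cardsFor-correct σ⁻¹-injective σ⁻¹-onto Q loopless)
    recover-cards : ∀ (A : CardSeq b n k σ) → cardsFor σ⁻¹ (thrownPairs (proj₁ A) σ⁻¹) ≡ proj₁ A
    recover-cards (A , valid , _) = cardsFor-thrownPairs σ⁻¹-injective σ⁻¹-onto A (VAllP.toList⁺ valid)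

-- the ball z as one of the k vertices (d if z ≥ k, which never happens for thrown balls)
cut : ∀ {k b} → Fin k → Fin b → Fin k
cut {k} d z with toℕ z <? k
... | yes z<k = fromℕ< z<k
... | no  _   = d

toℕ-cut : ∀ {k b} (d : Fin k) (z : Fin b) → toℕ z < k → toℕ (cut d z) ≡ toℕ z
toℕ-cut {k} d z z<k with toℕ z <? k
... | yes _   = toℕ-fromℕ< _
... | no  z≮k = ⊥-elim (z≮k z<k)

module Standardise {b k : ℕ} (k≤b : k ≤ b) where
  open ≡-Reasoning

  embed : Fin k → Fin b
  embed v = inject≤ v k≤b

  cut-embed : ∀ (d : Fin k) v → cut d (embed v) ≡ v
  cut-embed d v = toℕ-injective (trans (toℕ-cut d (embed v) (subst (_< k) (sym (toℕ-inject≤ v k≤b)) (toℕ<n v)))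
                                        (toℕ-inject≤ v k≤b))

  module Numbering {n} (G : Digraph n k) where
    arcs : List (Pair k)
    arcs = toList (proj₁ G)

    loopless : Loopless arcs
    loopless = VAllP.toList⁺ (proj₁ (proj₂ G))

    seen : List (Fin k)
    seen = firstSeen arcs

    seen-complete : ∀ v → v ∈ seen
    seen-complete v = incident-firstSeen arcs (VAnyP.toList⁺ (proj₂ (proj₂ G) v))

    seen-unique : Unique seen
    seen-unique = firstSeen-unique arcs loopless

    length-seen : length seen ≡ k
    length-seen = begin
      length seen                                  ≡⟨ cong length (sym (++-identityʳ seen)) ⟩
      length (seen ++ [])                          ≡⟨ cong (λ t → length (seen ++ t)) (sym nothing-untouched) ⟩
      length (seen ++ untouched arcs (allFin k))   ≡⟨ cong length (sym (restack-split arcs (allFin k))) ⟩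
      length (restack arcs (allFin k))
        ≡⟨ proj₂ (restack-preserves arcs (allFin k) loopless (allFin⁺ k) ∈-allFin) ⟩
      length (allFin k)                            ≡⟨ length-tabulate id ⟩
      k                                            ∎
      where
      nothing-untouched : untouched arcs (allFin k) ≡ []
      nothing-untouched with untouched arcs (allFin k) in eq
      ... | []    = refl
      ... | v ∷ _ = ⊥-elim (untouched-∉-firstSeen arcs (allFin k) (subst (v ∈_) (sym eq) (here refl)) (seen-complete v))

    rank : Fin k → Fin k
    rank v = fromℕ< (subst (position seen v <_) length-seen (position-< seen (seen-complete v)))

    toℕ-rank : ∀ v → toℕ (rank v) ≡ position seen v
    toℕ-rank v = toℕ-fromℕ< _

    unrank : Fin k → Fin k
    unrank i = nth i seen (toℕ i)

    numbering : Permutation′ k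
    numbering = permutation rank unrank rank-unrank unrank-rank
      where
      rank-unrank : ∀ i → rank (unrank i) ≡ i
      rank-unrank i = toℕ-injective (trans (toℕ-rank (unrank i))
        (position-nth seen i seen-unique (subst (toℕ i <_) (sym length-seen) (toℕ<n i))))
      unrank-rank : ∀ v → unrank (rank v) ≡ v
      unrank-rank v = trans (cong (nth (rank v) seen) (toℕ-rank v)) (nth-position seen (rank v) (seen-complete v))

    label : Fin k → Fin b
    label = embed ∘ rank

    toℕ-label : ∀ v → toℕ (label v) ≡ position seen v
    toℕ-label v = trans (toℕ-inject≤ (rank v) k≤b) (toℕ-rank v)

    label-injective : Injective _≡_ _≡_ label
    label-injective {v} {w} e = position-injective seen (seen-complete v) (seen-complete w)
      (trans (sym (toℕ-label v)) (trans (cong toℕ e) (toℕ-label w)))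

    labelled : Vec (Pair b) n
    labelled = V.map (mapPair label) (proj₁ G)

    standard : Standard b n k
    standard = labelled , labelled-loopless , labelled-seen
      where
      labelled-list : toList labelled ≡ map (mapPair label) arcs
      labelled-list = VP.toList-map (mapPair label) (proj₁ G)
      labelled-loopless : Loopless (toList labelled)
      labelled-loopless = subst Loopless (sym labelled-list)
        (AllP.map⁺ (All.map (λ v≢w e → v≢w (label-injective e)) loopless))
      labelled-seen : map toℕ (firstSeen (toList labelled)) ≡ range 0 k
      labelled-seen = begin
        map toℕ (firstSeen (toList labelled))        ≡⟨ cong (map toℕ ∘ firstSeen) labelled-list ⟩
        map toℕ (firstSeen (map (mapPair label) arcs))
          ≡⟨ cong (map toℕ) (map-firstSeen label arcs (λ _ _ → label-injective)) ⟩
        map toℕ (map label seen)                     ≡⟨ sym (map-∘ seen) ⟩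
        map (toℕ ∘ label) seen                       ≡⟨ map-cong toℕ-label seen ⟩
        map (position seen) seen                     ≡⟨ map-position seen seen-unique ⟩
        range 0 (length seen)                        ≡⟨ cong (range 0) length-seen ⟩
        range 0 k                                    ∎

  open Numbering using (standard; numbering; labelled)

  -- isomorphic digraphs are labelled alike: relabelling by π relabels the
  -- first-appearance list by π, so π v gets the number v had
  standard-cong : ∀ {n} {G H : Digraph n k} → G ≅ H → labelled G ≡ labelled H
  standard-cong {G = G} {H = ._ , H-digraph} (π , refl) = begin
    labelled G                                        ≡⟨ VP.map-cong (mapPair-cong same-label) (proj₁ G) ⟨
    V.map (mapPair (N′.label ∘ (π ⟨$⟩ʳ_))) (proj₁ G)  ≡⟨ VP.map-∘ _ _ (proj₁ G) ⟩
    labelled H′                                       ∎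
    where
    H′ : Digraph _ k
    H′ = relabel π (proj₁ G) , H-digraph
    module N = Numbering G
    module N′ = Numbering H′
    π-injective : Injective _≡_ _≡_ (π ⟨$⟩ʳ_)
    π-injective e = trans (sym (inverseˡ π)) (trans (cong (π ⟨$⟩ˡ_) e) (inverseˡ π))
    seen-relabelled : N′.seen ≡ map (π ⟨$⟩ʳ_) N.seen
    seen-relabelled = trans (cong firstSeen (VP.toList-map (mapPair (π ⟨$⟩ʳ_)) (proj₁ G)))
                            (map-firstSeen (π ⟨$⟩ʳ_) N.arcs (λ _ _ → π-injective))
    same-label : ∀ v → N′.label (π ⟨$⟩ʳ v) ≡ N.label v
    same-label v = toℕ-injective (begin
      toℕ (N′.label (π ⟨$⟩ʳ v))                     ≡⟨ N′.toℕ-label (π ⟨$⟩ʳ v) ⟩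
      position N′.seen (π ⟨$⟩ʳ v)                   ≡⟨ cong (λ t → position t (π ⟨$⟩ʳ v)) seen-relabelled ⟩
      position (map (π ⟨$⟩ʳ_) N.seen) (π ⟨$⟩ʳ v)     ≡⟨ position-map (π ⟨$⟩ʳ_) π-injective N.seen v ⟩
      position N.seen v                             ≡⟨ sym (N.toℕ-label v) ⟩
      toℕ (N.label v)                               ∎)

  -- the first ball thrown, as a vertex (used as a default; any vertex would do)
  firstVertex : ∀ {n} → Standard b (suc n) k → Fin k
  firstVertex ((x , y) ∷ Q , _ , seen≈) = fromℕ< (proj₂ (ranged⁻ (firstSeen ((x , y) ∷ toList Q)) seen≈ (here refl)))

  module Unlabel {n} (Q : Standard b (suc n) k) where
    pairs : List (Pair b)
    pairs = toList (proj₁ Q)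

    D : List (Fin b)
    D = firstSeen pairs

    below-k : ∀ {z} → z ∈ D → toℕ z < k
    below-k z∈ = proj₂ (ranged⁻ D (proj₂ (proj₂ Q)) z∈)

    d : Fin k
    d = firstVertex Q

    cut-injective : ∀ {z w} → z ∈ D → w ∈ D → cut d z ≡ cut d w → z ≡ w
    cut-injective z∈ w∈ e =
      toℕ-injective (trans (sym (toℕ-cut d _ (below-k z∈))) (trans (cong toℕ e) (toℕ-cut d _ (below-k w∈))))

    entries-seen : All (λ a → proj₁ a ∈ D × proj₂ a ∈ D) pairs
    entries-seen = All.tabulate (λ a∈ → incident-firstSeen pairs (Any.map (λ e → inj₁ (cong proj₁ (sym e))) a∈) ,
                                        incident-firstSeen pairs (Any.map (λ e → inj₂ (cong proj₂ (sym e))) a∈))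

    arcs : Vec (Arc k) (suc n)
    arcs = V.map (mapPair (cut d)) (proj₁ Q)

    arcs-list : toList arcs ≡ map (mapPair (cut d)) pairs
    arcs-list = VP.toList-map (mapPair (cut d)) (proj₁ Q)

    arcs-loopless : VAll.All (λ a → proj₁ a ≢ proj₂ a) arcs
    arcs-loopless = VAllP.toList⁻ (subst Loopless (sym arcs-list) (AllP.map⁺ (All.tabulate
      (λ a∈ e → All.lookup (proj₁ (proj₂ Q)) a∈
                  (cut-injective (proj₁ (All.lookup entries-seen a∈)) (proj₂ (All.lookup entries-seen a∈)) e)))))

    -- vertex v is the image of ball v, which is thrown
    arcs-cover : ∀ v → VAny.Any (λ a → (proj₁ a ≡ v) ⊎ (proj₂ a ≡ v)) arcs
    arcs-cover v = VAnyP.toList⁻ (subst (Incident v) (sym arcs-list) (AnyP.map⁺ (Any.map to-v (firstSeen-incident pairs v∈D))))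
      where
      v∈D : embed v ∈ D
      v∈D = ranged⁺ D (proj₂ (proj₂ Q)) (embed v) z≤n (subst (_< k) (sym (toℕ-inject≤ v k≤b)) (toℕ<n v))
      to-v : ∀ {a} → (proj₁ a ≡ embed v) ⊎ (proj₂ a ≡ embed v) →
                     (cut d (proj₁ a) ≡ v) ⊎ (cut d (proj₂ a) ≡ v)
      to-v (inj₁ e) = inj₁ (trans (cong (cut d) e) (cut-embed d v))
      to-v (inj₂ e) = inj₂ (trans (cong (cut d) e) (cut-embed d v))

    digraph : Digraph (suc n) k
    digraph = arcs , arcs-loopless , arcs-cover

  labelled-unlabel : ∀ {n} (Q : Standard b (suc n) k) → labelled (Unlabel.digraph Q) ≡ proj₁ Q
  labelled-unlabel Q = trans (sym (cast-is-id refl _)) (VP.toList-injective refl _ _ (begin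
    toList (labelled U.digraph)                            ≡⟨ VP.toList-map (mapPair N.label) U.arcs ⟩
    map (mapPair N.label) (toList U.arcs)                  ≡⟨ cong (map (mapPair N.label)) U.arcs-list ⟩
    map (mapPair N.label) (map (mapPair (cut U.d)) U.pairs) ≡⟨ map-∘ U.pairs ⟨
    map (mapPair (N.label ∘ cut U.d)) U.pairs
      ≡⟨ map-cong-local (All.map (λ (x∈ , y∈) → cong₂ _,_ (label-cut x∈) (label-cut y∈)) U.entries-seen) ⟩
    map id U.pairs                                         ≡⟨ map-id U.pairs ⟩
    U.pairs                                                ∎))
    where
    module U = Unlabel Q
    module N = Numbering U.digraph
    seen-cut : N.seen ≡ map (cut U.d) U.D
    seen-cut = trans (cong firstSeen U.arcs-list) (map-firstSeen (cut U.d) U.pairs U.cut-injective)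
    seen-cut≈ : map toℕ (map (cut U.d) U.D) ≡ range 0 k
    seen-cut≈ = trans (sym (map-∘ U.D)) (trans (map-cong-local (All.tabulate (λ x∈ → toℕ-cut U.d _ (U.below-k x∈))))
                                               (proj₂ (proj₂ Q)))
    label-cut : ∀ {x} → x ∈ U.D → N.label (cut U.d x) ≡ x
    label-cut {x} x∈ = toℕ-injective (begin
      toℕ (N.label (cut U.d x))                   ≡⟨ N.toℕ-label (cut U.d x) ⟩
      position N.seen (cut U.d x)                 ≡⟨ cong (λ t → position t (cut U.d x)) seen-cut ⟩
      position (map (cut U.d) U.D) (cut U.d x)    ≡⟨ position-ranged _ 0 k seen-cut≈ (∈-map⁺ (cut U.d) x∈) ⟩
      toℕ (cut U.d x)                             ≡⟨ toℕ-cut U.d x (U.below-k x∈) ⟩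
      toℕ x                                       ∎)

  unlabel-standard : ∀ {n} (G : Digraph (suc n) k) → G ≅ Unlabel.digraph (standard G)
  unlabel-standard G = numbering G , (begin
    relabel (numbering G) (proj₁ G)           ≡⟨ VP.map-cong (mapPair-cong (cut-embed d ∘ N.rank)) (proj₁ G) ⟨
    V.map (mapPair (cut d ∘ N.label)) (proj₁ G) ≡⟨ VP.map-∘ (mapPair (cut d)) (mapPair N.label) (proj₁ G) ⟩
    V.map (mapPair (cut d)) (labelled G)      ∎)
    where
    module N = Numbering G
    d = Unlabel.d (standard G)

  unlabel-cong : ∀ {n} {Q Q′ : Standard b (suc n) k} → proj₁ Q ≡ proj₁ Q′ → Unlabel.digraph Q ≅ Unlabel.digraph Q′
  unlabel-cong {n} {Q@((x , y) ∷ _ , _)} {._ , _} refl = Setoid.refl (DigraphSetoid (suc n) k) {Unlabel.digraph Q}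

  digraphs↔pairs : ∀ {n} → Inverse (DigraphSetoid (suc n) k) (StandardSetoid b (suc n) k)
  digraphs↔pairs {n} = record
    { to        = standard
    ; from      = Unlabel.digraph
    ; to-cong   = λ {G} {H} → standard-cong {G = G} {H = H}
    ; from-cong = λ {Q} {Q′} → unlabel-cong {Q = Q} {Q′ = Q′}
    ; inverse   = (λ {Q} {G} G≅ → trans (standard-cong {G = G} {H = Unlabel.digraph Q} G≅) (labelled-unlabel Q))
                , (λ {G} {Q} Q≡ → DS.trans {Unlabel.digraph Q} {Unlabel.digraph (standard G)} {G}
                                    (unlabel-cong {Q = Q} {Q′ = standard G} Q≡)
                                    (DS.sym {G} {Unlabel.digraph (standard G)} (unlabel-standard G)))
    }
    where module DS = Setoid (DigraphSetoid (suc n) k)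

-- Digraphs ↔ standard pair sequences ↔ card sequences; n ≥ 1 supplies a
-- first arc, whose first ball serves as the default vertex when unlabelling.
theorem2p6 : (b : ℕ) (σ : Permutation′ b) (n k : ℕ) →
    1 ≤ n → b ∸ L σ ≤ k → k ≤ b →
    Bijection (DigraphSetoid n k) (CardSeqSetoid b n k σ)
theorem2p6 b σ zero    k ()    _       _
theorem2p6 b σ (suc n) k _     L-bound k≤b =
  Inverse⇒Bijection (inverse (Standardise.digraphs↔pairs k≤b)
                             (CardsAsPairs.pairs↔cards σ k≤b L-bound (suc n)))
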